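{- Let $w$ be a non-empty word over an alphabet $\Sigma$ and $t\ge 1$. Then: (1) if $SP_t(w)=0$, then $SP_{t+k}(w)=0$ for all $k\ge 1$; (2) if $t$ is odd, then $SP_t(w)\ge SP_{t+1}(w)$.
   Context: A scattered subword of $w$ is a (not necessarily contiguous) subsequence of $w$. A palindrome is a word equal to its reversal. For $t\ge 1$, $SP_t(w)$ is the number of distinct palindromes of length $t$ that are scattered subwords of $w$. -}

module Defs where

open import Data.Nat using (ℕ; zero; suc)
open import Data.List using (List; []; _∷_; map; _++_; length; reverse; filter; deduplicate)
open import Data.List.Properties using (≡-dec)
open import Relation.Binary.Definitions using (DecidableEquality)
open import Relation.Binary.PropositionalEquality using (_≡_)

-- All scattered subwords (subsequences, not necessarily contiguous) of w,
-- listed with multiplicity (one entry per choice of positions).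
subwords : {A : Set} → List A → List (List A)
subwords []       = [] ∷ []
subwords (x ∷ xs) = let r = subwords xs in map (x ∷_) r ++ r

IsPalindrome : {A : Set} → List A → Set
IsPalindrome u = reverse u ≡ u

SP : {A : Set} → DecidableEquality A → ℕ → List A → ℕ
SP _≟_ t w =
  length (filter (λ u → ≡-dec _≟_ (reverse u) u)
           (filter (λ u → Data.Nat._≟_ (length u) t)
             (deduplicate (≡-dec _≟_) (subwords w))))

open import Data.Nat using (_*_)
open import Data.Product using (∃)

Odd : ℕ → Set
Odd t = ∃ λ m → t ≡ suc (2 * m)

{-# OPTIONS --safe #-}
module Submission where

-- A palindrome u of length n + 1 is the mirror image a · m · reverse a of its first ⌊(n+1)/2⌋
-- letters around a middle palindrome m of length 1 or 2; deleting one letter of m leaves a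
-- palindromic subword of length n, and iterating gives (1). For (2), an even palindrome
-- a · x x · reverse a of length 2h + 2 is recovered from the odd palindrome a · x · reverse a
-- obtained by deleting its letter at position h, so this deletion injects the palindromic
-- subwords of length 2h + 2 into those of length 2h + 1.

open import Defs
open import Data.Nat using (ℕ; zero; suc; _+_; _*_; _≤_; _≥_; z≤n; s≤s)
open import Data.Nat.Properties using (+-suc; +-comm; suc-injective)
open import Data.Nat.Tactic.RingSolver using (solve-∀)
open import Data.List using (List; []; _∷_; _++_; [_]; length; reverse; map; filter; deduplicate)
open import Data.List.Properties using (≡-dec; length-++; length-reverse; reverse-++; reverse-involutive; ++-assoc; ∷-injective; length-removeAt′)
open import Data.List.Membership.Propositional using (_∈_; _∉_; _─_)
open import Data.List.Membership.Propositional.Properties using (∈-map⁺; ∈-map⁻; ∈-++⁺ˡ; ∈-++⁺ʳ; ∈-++⁻; ∈-filter⁺; ∈-filter⁻; ∈-deduplicate⁺; ∈-deduplicate⁻)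
open import Data.List.Relation.Unary.Any using (here; there)
open import Data.List.Relation.Unary.All using () renaming (lookup to All-lookup)
open import Data.List.Relation.Unary.AllPairs using (_∷_)
open import Data.List.Relation.Unary.Unique.Propositional using (Unique)
import Data.List.Relation.Unary.Unique.Propositional.Properties as Unique
import Data.List.Relation.Unary.Unique.DecPropositional.Properties as DecUnique
open import Data.List.Relation.Binary.Sublist.Propositional using (_⊆_; []; _∷_; _∷ʳ_; ⊆-refl; ⊆-trans; minimum)
open import Data.List.Relation.Binary.Sublist.Propositional.Properties using (++⁺)
open import Data.Product using (_×_; _,_; ∃; ∃₂; proj₁; proj₂)
open import Data.Sum using (_⊎_; inj₁; inj₂)
open import Data.Empty using (⊥-elim)
open import Relation.Binary.Definitions using (DecidableEquality)
open import Relation.Binary.PropositionalEquality using (_≡_; _≢_; refl; sym; trans; cong; subst; module ≡-Reasoning)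

even-or-odd : ∀ n → ∃ λ h → n ≡ 2 * h ⊎ n ≡ suc (2 * h)
even-or-odd zero = 0 , inj₁ refl
even-or-odd (suc n) with even-or-odd n
... | h , inj₁ refl = h , inj₂ refl
... | h , inj₂ refl = suc h , inj₁ (cong suc (sym (+-suc h (h + 0))))

k+2*n≡n+[k+n] : ∀ k n → k + 2 * n ≡ n + (k + n)
k+2*n≡n+[k+n] = solve-∀

module _ {A : Set} where

  ∈-─⁺ : ∀ {x y} {xs : List A} → y ∈ xs → (p : x ∈ xs) → y ≢ x → y ∈ xs ─ p
  ∈-─⁺ (here refl) (here refl) y≢x = ⊥-elim (y≢x refl)
  ∈-─⁺ (there q)   (here _)    _   = q
  ∈-─⁺ (here e)    (there _)   _   = here e
  ∈-─⁺ (there q)   (there p)   y≢x = there (∈-─⁺ q p y≢x)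

  ∉-all⇒length≡0 : (xs : List A) → (∀ {x} → x ∉ xs) → length xs ≡ 0
  ∉-all⇒length≡0 []      _   = refl
  ∉-all⇒length≡0 (_ ∷ _) ∉xs = ⊥-elim (∉xs (here refl))

  ∈⇒length≢0 : ∀ {x} {xs : List A} → x ∈ xs → length xs ≢ 0
  ∈⇒length≢0 (here _)  ()
  ∈⇒length≢0 (there _) ()

length-≤-via-injection : ∀ {B C : Set} (f : B → C) (xs : List B) (ys : List C) → Unique xs →
  (∀ {x} → x ∈ xs → f x ∈ ys) →
  (∀ {x y} → x ∈ xs → y ∈ xs → f x ≡ f y → x ≡ y) →
  length xs ≤ length ys
length-≤-via-injection f []       ys _          _     _   = z≤n
length-≤-via-injection f (x ∷ xs) ys (x∉ ∷ uxs) maps∈ inj =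
  subst (suc (length xs) ≤_) (sym (length-removeAt′ ys _))
    (s≤s (length-≤-via-injection f xs (ys ─ fx∈) uxs maps∈─ (λ p q → inj (there p) (there q))))
  where
  fx∈ : f x ∈ ys
  fx∈ = maps∈ (here refl)
  maps∈─ : ∀ {y} → y ∈ xs → f y ∈ ys ─ fx∈
  maps∈─ y∈ = ∈-─⁺ (maps∈ (there y∈)) fx∈ λ fy≡fx → All-lookup x∉ y∈ (sym (inj (there y∈) (here refl) fy≡fx))

module _ {A : Set} where

  ++-injective : ∀ (a b : List A) {c d} → length a ≡ length b → a ++ c ≡ b ++ d → a ≡ b × c ≡ d
  ++-injective []      []      _   c≡d = refl , c≡d
  ++-injective []      (_ ∷ _) ()  _
  ++-injective (_ ∷ _) []      ()  _
  ++-injective (x ∷ a) (y ∷ b) len eq with ∷-injective eq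
  ... | refl , eq′ with ++-injective a b (suc-injective len) eq′
  ...   | refl , c≡d = refl , c≡d

  splitAt-length : ∀ n (u : List A) {r} → length u ≡ n + r →
    ∃₂ λ a b → u ≡ a ++ b × length a ≡ n × length b ≡ r
  splitAt-length zero    u       len = [] , u , refl , refl , len
  splitAt-length (suc n) []      ()
  splitAt-length (suc n) (x ∷ u) len with splitAt-length n u (suc-injective len)
  ... | a , b , refl , refl , lb = x ∷ a , b , refl , refl , lb

  deleteAt : ℕ → List A → List A
  deleteAt _       []       = []
  deleteAt zero    (x ∷ xs) = xs
  deleteAt (suc n) (x ∷ xs) = x ∷ deleteAt n xs

  deleteAt-⊆ : ∀ n u → deleteAt n u ⊆ u
  deleteAt-⊆ _       []       = []
  deleteAt-⊆ zero    (x ∷ xs) = x ∷ʳ ⊆-refl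
  deleteAt-⊆ (suc n) (x ∷ xs) = refl ∷ deleteAt-⊆ n xs

  deleteAt-++ : ∀ a (x : A) r → deleteAt (length a) (a ++ x ∷ r) ≡ a ++ r
  deleteAt-++ []      x r = refl
  deleteAt-++ (y ∷ a) x r = cong (y ∷_) (deleteAt-++ a x r)

  ∈-subwords⁺ : ∀ {u w : List A} → u ⊆ w → u ∈ subwords w
  ∈-subwords⁺ []                  = here refl
  ∈-subwords⁺ (_∷ʳ_ {ys = w} y p) = ∈-++⁺ʳ (map (y ∷_) (subwords w)) (∈-subwords⁺ p)
  ∈-subwords⁺ (refl ∷ p)          = ∈-++⁺ˡ (∈-map⁺ _ (∈-subwords⁺ p))

  ∈-subwords⁻ : ∀ w {u : List A} → u ∈ subwords w → u ⊆ w
  ∈-subwords⁻ []      (here refl) = []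
  ∈-subwords⁻ (x ∷ w) u∈ with ∈-++⁻ (map (x ∷_) (subwords w)) u∈
  ... | inj₂ u∈′ = x ∷ʳ ∈-subwords⁻ w u∈′
  ... | inj₁ u∈′ with ∈-map⁻ (x ∷_) u∈′
  ...   | v , v∈ , refl = refl ∷ ∈-subwords⁻ w v∈

  mirror : List A → List A → List A
  mirror a m = a ++ m ++ reverse a

  length-mirror : ∀ a m → length (mirror a m) ≡ length m + 2 * length a
  length-mirror a m = begin
    length (a ++ m ++ reverse a)                 ≡⟨ length-++ a ⟩
    length a + length (m ++ reverse a)           ≡⟨ cong (length a +_) (length-++ m) ⟩
    length a + (length m + length (reverse a))   ≡⟨ cong (λ l → length a + (length m + l)) (length-reverse a) ⟩
    length a + (length m + length a)             ≡⟨ sym (k+2*n≡n+[k+n] (length m) (length a)) ⟩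
    length m + 2 * length a                      ∎
    where open ≡-Reasoning

  reverse-mirror : ∀ a m → reverse (mirror a m) ≡ mirror a (reverse m)
  reverse-mirror a m = begin
    reverse (a ++ m ++ reverse a)                   ≡⟨ reverse-++ a (m ++ reverse a) ⟩
    reverse (m ++ reverse a) ++ reverse a           ≡⟨ cong (_++ reverse a) (reverse-++ m (reverse a)) ⟩
    (reverse (reverse a) ++ reverse m) ++ reverse a ≡⟨ cong (λ b → (b ++ reverse m) ++ reverse a) (reverse-involutive a) ⟩
    (a ++ reverse m) ++ reverse a                   ≡⟨ ++-assoc a (reverse m) (reverse a) ⟩
    a ++ reverse m ++ reverse a                     ∎
    where open ≡-Reasoning

  mirror-palindrome : ∀ a {m} → IsPalindrome m → IsPalindrome (mirror a m)
  mirror-palindrome a {m} pal = trans (reverse-mirror a m) (cong (mirror a) pal)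

  mirror-⊆ : ∀ a {m m′} → m′ ⊆ m → mirror a m′ ⊆ mirror a m
  mirror-⊆ a m′⊆m = ++⁺ (⊆-refl {x = a}) (++⁺ m′⊆m (⊆-refl {x = reverse a}))

  palindrome⇒mirror : ∀ n k {u} → IsPalindrome u → length u ≡ k + 2 * n →
    ∃₂ λ a m → u ≡ mirror a m × length a ≡ n × length m ≡ k × IsPalindrome m
  palindrome⇒mirror n k {u} pal len
    with splitAt-length n u (trans len (k+2*n≡n+[k+n] k n))
  ... | a , r , refl , la , lr with splitAt-length k r lr
  ...   | m , c , refl , lm , lc = a , m , cong (λ b → a ++ m ++ b) c≡ra , la , lm , m-pal
    where
    open ≡-Reasoning
    reverse-split : reverse c ++ reverse m ++ reverse a ≡ a ++ m ++ c
    reverse-split = begin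
      reverse c ++ reverse m ++ reverse a    ≡⟨ sym (++-assoc (reverse c) (reverse m) (reverse a)) ⟩
      (reverse c ++ reverse m) ++ reverse a  ≡⟨ cong (_++ reverse a) (sym (reverse-++ m c)) ⟩
      reverse (m ++ c) ++ reverse a          ≡⟨ sym (reverse-++ a (m ++ c)) ⟩
      reverse (a ++ m ++ c)                  ≡⟨ pal ⟩
      a ++ m ++ c                            ∎
    outer : reverse c ≡ a × reverse m ++ reverse a ≡ m ++ c
    outer = ++-injective (reverse c) a (trans (length-reverse c) (trans lc (sym la))) reverse-split
    m-pal : IsPalindrome m
    m-pal = proj₁ (++-injective (reverse m) m (length-reverse m) (proj₂ outer))
    c≡ra : c ≡ reverse a
    c≡ra = trans (sym (reverse-involutive c)) (cong reverse (proj₁ outer))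

  palindrome-of-length-2 : ∀ {m : List A} → IsPalindrome m → length m ≡ 2 → ∃ λ x → m ≡ x ∷ x ∷ []
  palindrome-of-length-2 {x ∷ _ ∷ []}    refl refl = x , refl
  palindrome-of-length-2 {[]}            _    ()
  palindrome-of-length-2 {_ ∷ []}        _    ()
  palindrome-of-length-2 {_ ∷ _ ∷ _ ∷ _} _    ()

  even-palindrome⇒mirror : ∀ h {u} → IsPalindrome u → length u ≡ 2 + 2 * h →
    ∃₂ λ a x → u ≡ mirror a (x ∷ x ∷ []) × length a ≡ h
  even-palindrome⇒mirror h pal len with palindrome⇒mirror h 2 pal len
  ... | a , m , refl , la , lm , m-pal with palindrome-of-length-2 m-pal lm
  ...   | x , refl = a , x , refl , la

  PalSubword : ℕ → List A → List A → Set
  PalSubword n w u = u ⊆ w × length u ≡ n × IsPalindrome u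

  palSubword-⊆ : ∀ {n v w u} → v ⊆ w → PalSubword n v u → PalSubword n w u
  palSubword-⊆ v⊆w (u⊆v , len , pal) = ⊆-trans u⊆v v⊆w , len , pal

  deleteAt-middle : ∀ h {u} → IsPalindrome u → length u ≡ 2 + 2 * h → PalSubword (1 + 2 * h) u (deleteAt h u)
  deleteAt-middle h pal len with even-palindrome⇒mirror h pal len
  ... | a , x , refl , refl rewrite deleteAt-++ a x (x ∷ reverse a) =
    mirror-⊆ a (x ∷ʳ ⊆-refl) , length-mirror a [ x ] , mirror-palindrome a refl

  deleteAt-middle-injective : ∀ h {u u′} →
    IsPalindrome u → length u ≡ 2 + 2 * h → IsPalindrome u′ → length u′ ≡ 2 + 2 * h →
    deleteAt h u ≡ deleteAt h u′ → u ≡ u′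
  deleteAt-middle-injective h pal len pal′ len′ eq
    with even-palindrome⇒mirror h pal len | even-palindrome⇒mirror h pal′ len′
  ... | a , x , refl , refl | a′ , x′ , refl , la′
    rewrite deleteAt-++ a x (x ∷ reverse a) | sym la′ | deleteAt-++ a′ x′ (x′ ∷ reverse a′)
    with ++-injective a a′ (sym la′) eq
  ...   | refl , eq′ with ∷-injective eq′
  ...     | refl , _ = refl

  palindrome-shrink : ∀ {n u} → IsPalindrome u → length u ≡ suc n → ∃ (PalSubword n u)
  palindrome-shrink {n} {u} pal len with even-or-odd n
  ... | h , inj₂ refl = deleteAt h u , deleteAt-middle h pal len
  ... | h , inj₁ refl with palindrome⇒mirror h 1 pal len
  ...   | a , m , refl , refl , _ =
    mirror a [] , mirror-⊆ a (minimum m) , length-mirror a [] , mirror-palindrome a refl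

  palSubword-shorten : ∀ t k {w u} → PalSubword (k + t) w u → ∃ (PalSubword t w)
  palSubword-shorten t zero    pu                = _ , pu
  palSubword-shorten t (suc k) (u⊆w , len , pal) with palindrome-shrink pal len
  ... | _ , pv = palSubword-shorten t k (palSubword-⊆ u⊆w pv)

module _ {A : Set} (_≟_ : DecidableEquality A) where

  -- Chosen so that SP _≟_ t w is definitionally length (palSubwords t w).
  palSubwords : ℕ → List A → List (List A)
  palSubwords t w = filter (λ u → ≡-dec _≟_ (reverse u) u)
                     (filter (λ u → Data.Nat._≟_ (length u) t)
                       (deduplicate (≡-dec _≟_) (subwords w)))

  ∈-palSubwords⁺ : ∀ {t w u} → PalSubword t w u → u ∈ palSubwords t w
  ∈-palSubwords⁺ {t} (u⊆w , len , pal) =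
    ∈-filter⁺ (λ u → ≡-dec _≟_ (reverse u) u)
      (∈-filter⁺ (λ u → Data.Nat._≟_ (length u) t)
        (∈-deduplicate⁺ (≡-dec _≟_) (∈-subwords⁺ u⊆w)) len) pal

  ∈-palSubwords⁻ : ∀ {t} w {u} → u ∈ palSubwords t w → PalSubword t w u
  ∈-palSubwords⁻ {t} w u∈ with ∈-filter⁻ (λ u → ≡-dec _≟_ (reverse u) u) u∈
  ... | u∈′ , pal with ∈-filter⁻ (λ u → Data.Nat._≟_ (length u) t) u∈′
  ...   | u∈″ , len = ∈-subwords⁻ w (∈-deduplicate⁻ (≡-dec _≟_) (subwords w) u∈″) , len , pal

  palSubwords-unique : ∀ t w → Unique (palSubwords t w)
  palSubwords-unique t w =
    Unique.filter⁺ (λ u → ≡-dec _≟_ (reverse u) u)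
      (Unique.filter⁺ (λ u → Data.Nat._≟_ (length u) t)
        (DecUnique.deduplicate-! (≡-dec _≟_) (subwords w)))

  SP-zero-upward : ∀ w t k → SP _≟_ t w ≡ 0 → SP _≟_ (t + k) w ≡ 0
  SP-zero-upward w t k SPt≡0 = ∉-all⇒length≡0 (palSubwords (t + k) w) λ u∈ →
    let u⊆w , len , pal = ∈-palSubwords⁻ w u∈
        _ , pv = palSubword-shorten t k (u⊆w , trans len (+-comm t k) , pal)
    in ∈⇒length≢0 (∈-palSubwords⁺ {w = w} pv) SPt≡0

  SP-even≤SP-odd : ∀ w h → SP _≟_ (2 + 2 * h) w ≤ SP _≟_ (1 + 2 * h) w
  SP-even≤SP-odd w h =
    length-≤-via-injection (deleteAt h) (palSubwords (2 + 2 * h) w) (palSubwords (1 + 2 * h) w)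
      (palSubwords-unique _ w) maps∈ injective
    where
    maps∈ : ∀ {u} → u ∈ palSubwords (2 + 2 * h) w → deleteAt h u ∈ palSubwords (1 + 2 * h) w
    maps∈ u∈ = let u⊆w , len , pal = ∈-palSubwords⁻ w u∈ in
      ∈-palSubwords⁺ {w = w} (palSubword-⊆ u⊆w (deleteAt-middle h pal len))
    injective : ∀ {u u′} → u ∈ palSubwords (2 + 2 * h) w → u′ ∈ palSubwords (2 + 2 * h) w →
      deleteAt h u ≡ deleteAt h u′ → u ≡ u′
    injective u∈ u′∈ =
      let _ , len , pal = ∈-palSubwords⁻ w u∈
          _ , len′ , pal′ = ∈-palSubwords⁻ w u′∈
      in deleteAt-middle-injective h pal len pal′ len′

lemma4p5 : {Σ : Set} (_≟_ : DecidableEquality Σ) (w : List Σ) (t : ℕ) →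
    w ≢ [] → 1 ≤ t →
    ((SP _≟_ t w ≡ 0 → (k : ℕ) → 1 ≤ k → SP _≟_ (t + k) w ≡ 0)
    × (Odd t → SP _≟_ t w ≥ SP _≟_ (suc t) w))
lemma4p5 _≟_ w t _ _ =
  (λ SPt≡0 k _ → SP-zero-upward _≟_ w t k SPt≡0) ,
  λ { (h , refl) → SP-even≤SP-odd _≟_ w h }
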